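{- Suppose $k,p\in\mathbb{N}$ with $p$ prime, and $f\in\mathbb{Z}[x]$ has degree $d$. Then: (1) The depth of $\mathcal{T}(f,p,k)$ is at most $\lfloor (k-1)/2\rfloor$. (2) The degree of the root node of $\mathcal{T}(f,p,k)$ is at most $\lfloor d/2\rfloor$. (3) The degree of any non-root node of $\mathcal{T}(f,p,k)$ labelled $(f_{i,\zeta},k_{i,\zeta})$, with parent $(f_{i-1,\mu},k_{i-1,\mu})$ and $\zeta_{i-1}:=(\zeta-\mu)/p^{i-1}$, is at most $\lfloor s(f_{i-1,\mu},\zeta_{i-1})/2\rfloor$. In particular, $\deg \tilde{f}_{i,\zeta}\leq s(f_{i-1,\mu},\zeta_{i-1})\leq k_{i-1,\mu}-1\leq k-1$ and $\sum_{(f_{i,\zeta},k_{i,\zeta}) \text{ a child of } (f_{i-1,\mu},k_{i-1,\mu})} s(f_{i-1,\mu},\zeta_{i-1})\leq \deg \tilde{f}_{i-1,\mu}$. (4) $\mathcal{T}(f,p,k)$ has at most $\lfloor d/2\rfloor$ nodes at depth $i\geq 1$, and thus a total of no greater than $1+\lfloor d/2\rfloor\lfloor (k-1)/2\rfloor$ nodes.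
   Context: For $f\in\mathbb{Z}[x]$, $\tilde{f}$ denotes the mod $p$ reduction of $f$. A root $\zeta_0\in\{0,\ldots,p-1\}$ of $\tilde{f}$ is degenerate iff $f'(\zeta_0)=0$ mod $p$. With $\mathrm{ord}_p$ the $p$-adic valuation, $s(f,\zeta_0):=\min_{i\geq 0}\{i+\mathrm{ord}_p \frac{f^{(i)}(\zeta_0)}{i!}\}$. Fixing $k$, the set $T(f,p,k)$ of pairs $(f_{i,\zeta},k_{i,\zeta})\in\mathbb{Z}[x]\times\mathbb{N}$ is defined inductively: $(f_{0,0},k_{0,0}):=(f,k)$; for $i\geq1$, any $(f_{i-1,\mu},k_{i-1,\mu})\in T(f,p,k)$ and any degenerate root $\zeta_{i-1}\in\mathbb{Z}/(p)$ of $\tilde{f}_{i-1,\mu}$ with $s(f_{i-1,\mu},\zeta_{i-1})\in\{2,\ldots,k_{i-1,\mu}-1\}$, set $\zeta:=\mu+p^{i-1}\zeta_{i-1}$, $k_{i,\zeta}:=k_{i-1,\mu}-s(f_{i-1,\mu},\zeta_{i-1})$, and $f_{i,\zeta}(x):=\left[\frac{1}{p^{s(f_{i-1,\mu},\zeta_{i-1})}}f_{i-1,\mu}(\zeta_{i-1}+px)\right]$ mod $p^{k_{i,\zeta}}$. The rooted directed tree $\mathcal{T}(f,p,k)$ has nodes labelled by the elements of $T(f,p,k)$, root node $(f_{0,0},k_{0,0})$, and an edge from $(f_{i',\zeta'},k_{i',\zeta'})$ to $(f_{i,\zeta},k_{i,\zeta})$ iff $i'=i-1$ and there is a degenerate root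 $\zeta_{i-1}\in\mathbb{Z}/(p)$ of $\tilde{f}_{i',\zeta'}$ with $s(f_{i',\zeta'},\zeta_{i-1})\in\{2,\ldots,k_{i',\zeta'}-1\}$ and $\zeta=\zeta'+p^{i-1}\zeta_{i-1}$ (edge labelled $p^{s(f_{i',\zeta'},\zeta_{i-1})-1}$). -}

module Defs where

open import Data.Nat as ℕ using (ℕ; zero; suc; _∸_; _^_; _!; _≤_)
open import Data.Integer as ℤ using (ℤ; +_; 0ℤ; _/ℕ_; _%ℕ_)
open import Data.Integer.Divisibility using (_∣_)
open import Data.List using (List; []; _∷_; map)
open import Data.Bool using (Bool; true; false; if_then_else_; _∧_)
open import Data.Product using (_×_; ∃; ∃-syntax)
open import Function using (_∘_)
open import Relation.Nullary using (¬_; does)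

-- Integer polynomials as coefficient lists, constant term first:
-- a₀ ∷ a₁ ∷ … represents a₀ + a₁ x + …  (trailing zeros allowed).

Poly : Set
Poly = List ℤ

isZeroPoly : Poly → Bool
isZeroPoly []       = true
isZeroPoly (a ∷ as) = does (a ℤ.≟ 0ℤ) ∧ isZeroPoly as

-- degree = largest index of a nonzero coefficient (0 for the zero polynomial)
deg : Poly → ℕ
deg []       = 0
deg (a ∷ as) = if isZeroPoly as then 0 else suc (deg as)

_+ₚ_ : Poly → Poly → Poly
[]       +ₚ q        = q
(a ∷ as) +ₚ []       = a ∷ as
(a ∷ as) +ₚ (b ∷ bs) = (a ℤ.+ b) ∷ (as +ₚ bs)

scale : ℤ → Poly → Poly
scale c = map (c ℤ.*_)

_*ₚ_ : Poly → Poly → Poly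
[]       *ₚ q = []
(a ∷ as) *ₚ q = scale a q +ₚ (0ℤ ∷ (as *ₚ q))

compose : Poly → Poly → Poly
compose []       h = []
compose (a ∷ as) h = (a ∷ []) +ₚ (h *ₚ compose as h)

eval : Poly → ℤ → ℤ
eval []       z = 0ℤ
eval (a ∷ as) z = a ℤ.+ z ℤ.* eval as z

derivAux : ℕ → Poly → Poly
derivAux n []       = []
derivAux n (a ∷ as) = (+ n ℤ.* a) ∷ derivAux (suc n) as

deriv : Poly → Poly
deriv []       = []
deriv (a ∷ as) = derivAux 1 as

derivⁱ : ℕ → Poly → Poly
derivⁱ zero    g = g
derivⁱ (suc i) g = deriv (derivⁱ i g)

-- total wrappers for division / reduction by a natural number m
-- (the junk values at m = 0 are never used: m is always a power of a prime)
divZ : ℕ → ℤ → ℤ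
divZ zero    a = 0ℤ
divZ (suc m) a = a /ℕ suc m

modZ : ℕ → ℤ → ℤ
modZ zero    a = a
modZ (suc m) a = + (a %ℕ suc m)

hasse : Poly → ℕ → ℤ → ℤ
hasse g i z = divZ (i !) (eval (derivⁱ i g) z)

-- coefficientwise reduction mod m (for m = p this is f̃)
reduce : ℕ → Poly → Poly
reduce m = map (modZ m)

-- p-adic valuation: Ord p n v  ⟺  ord_p n = v  (never holds for n = 0,
-- i.e. ord_p 0 = ∞)
Ord : ℕ → ℤ → ℕ → Set
Ord p n v = (+ (p ^ v) ∣ n) × ¬ (+ (p ^ suc v) ∣ n)

-- IsS p g z s  ⟺  s(g, z) = min_i { i + ord_p (g^{(i)}(z)/i!) } = s  (finite)
IsS : ℕ → Poly → ℕ → ℕ → Set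
IsS p g z s =
  (∃[ i ] ∃[ v ] (Ord p (hasse g i (+ z)) v × i ℕ.+ v ≡ s)) ×
  (∀ i v → Ord p (hasse g i (+ z)) v → s ≤ i ℕ.+ v)
  where open import Relation.Binary.PropositionalEquality using (_≡_)

DegenerateRoot : ℕ → Poly → ℕ → Set
DegenerateRoot p g z =
  (z ℕ.< p) × (+ p ∣ eval g (+ z)) × (+ p ∣ eval (deriv g) (+ z))

-- condition for the digit z to give a child of a node (g, κ), with s = s(g,z)
ChildCond : ℕ → Poly → ℕ → ℕ → ℕ → Set
ChildCond p g κ z s =
  DegenerateRoot p g z × IsS p g z s × (2 ≤ s) × (s ≤ κ ∸ 1)

childPoly : ℕ → Poly → ℕ → ℕ → ℕ → Poly
childPoly p g κ z s =
  reduce (p ^ (κ ∸ s)) (map (divZ (p ^ s)) (compose g (+ z ∷ + p ∷ [])))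

-- The tree 𝒯(f,p,k).  Node p k f i ζ g κ : the node indexed by (i, ζ)
-- exists and is labelled (f_{i,ζ}, k_{i,ζ}) = (g, κ).
data Node (p k : ℕ) (f : Poly) : ℕ → ℕ → Poly → ℕ → Set where
  root  : Node p k f 0 0 f k
  child : ∀ {i μ g κ} → Node p k f i μ g κ →
          (z s : ℕ) → ChildCond p g κ z s →
          Node p k f (suc i) (μ ℕ.+ p ^ i ℕ.* z) (childPoly p g κ z s) (κ ∸ s)

module Submission where

-- The algebraic core is a root count over 𝔽_p.  Writing taylor g j z for the
-- coefficient of yʲ in g(z + y), the normalised derivatives g⁽ʲ⁾(z)/j! are
-- these Taylor coefficients, and the child polynomial g(z + p x)/p^s has
-- coefficients p^{j-s}·taylor g j z.  Hence a child (z, s) of a node is a root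
-- of g̃ of multiplicity ≥ s, while the child polynomial has degree ≤ s mod p.
-- Dividing repeatedly by x - z shows that the multiplicities of distinct
-- roots add up to at most the degree mod p; as every s ≥ 2, a node of degree
-- D has at most ⌊D/2⌋ children.  The tree part is a budget invariant
-- (2i + κ ≤ k gives the depth bound) and an induction on the depth: nodes at
-- depth i+1, grouped by their last base-p digit z, lie in the subtrees of the
-- children (z, s) of the root, each holding at most ⌊s/2⌋ of them.

open import Defs
open import Data.Nat using (ℕ; _+_; _*_; _∸_; _/_; _≤_)
open import Data.Nat.Primality using (Prime)
open import Data.Integer using (ℤ; +_)
open import Data.Integer.Divisibility using (_∣_)
open import Data.List using (List; map; length)
open import Data.Nat.ListAction using (sum)
open import Data.List.Relation.Unary.All using (All)
open import Data.List.Relation.Unary.Unique.Propositional using (Unique)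
open import Data.Product using (_×_; _,_; proj₁; proj₂; ∃-syntax)
open import Relation.Nullary using (¬_)
open import Relation.Binary.PropositionalEquality using (_≡_)

open import Data.Bool using (true; false)
open import Data.Empty using (⊥-elim)
open import Data.Product using (Σ)
open import Data.Sum using (_⊎_; inj₁; inj₂)
import Data.Sum as Sum
open import Relation.Nullary using (yes; no)
open import Relation.Binary.Definitions using (tri<; tri≈; tri>)
open import Relation.Binary.PropositionalEquality
  using (_≢_; refl; sym; trans; cong; cong₂; subst; module ≡-Reasoning)

open import Data.Nat using (zero; suc; _<_; _!; _^_; z≤n; s≤s; NonZero; >-nonZero; >-nonZero⁻¹)
import Data.Nat.Properties as ℕP
open import Algebra.Properties.CommutativeSemigroup ℕP.*-commutativeSemigroup using (x∙yz≈y∙xz)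
open import Data.Nat.DivMod
  using (_%_; m≡m%n+[m/n]*n; [m+kn]%n≡m%n; m<n⇒m%n≡m; m%n<n; m*n/n≡m; /-monoˡ-≤)
import Data.Nat.Divisibility as ℕD
open import Data.Nat.Primality using (euclidsLemma; prime⇒nonZero)

open import Data.Integer as ℤ using (0ℤ; _/ℕ_; _%ℕ_)
import Data.Integer.Properties as ℤP
open import Data.Integer.DivMod using (a≡a%ℕn+[a/ℕn]*n; n%ℕd<d)
open import Data.Integer.Divisibility.Signed as ℤS using (divides; ∣ᵤ⇒∣; ∣⇒∣ᵤ)
open import Data.Integer.Tactic.RingSolver using (solve-∀)

open import Data.List using ([]; _∷_; drop; filter)
open import Data.List.Properties using (filter-accept; filter-reject; length-map)
open import Data.List.Relation.Unary.All using ([]; _∷_)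
import Data.List.Relation.Unary.All as All
import Data.List.Relation.Unary.All.Properties as AllP
open import Data.List.Relation.Unary.AllPairs using ([]; _∷_)
import Data.List.Relation.Unary.Unique.Propositional.Properties as UniqueP

-- taylor g j z is the coefficient of yʲ in g(z + y).  Writing g = a + x·h
-- gives g(z + y) = a + (z + y)·h(z + y), which is the recursion below.
taylor : Poly → ℕ → ℤ → ℤ
taylor []       j       z = 0ℤ
taylor (a ∷ as) zero    z = a ℤ.+ z ℤ.* taylor as zero z
taylor (a ∷ as) (suc j) z = taylor as j z ℤ.+ z ℤ.* taylor as (suc j) z

taylor-zero : ∀ g z → taylor g 0 z ≡ eval g z
taylor-zero []       z = refl
taylor-zero (a ∷ as) z = cong (λ t → a ℤ.+ z ℤ.* t) (taylor-zero as z)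

rise : ℕ → ℕ → ℕ
rise n zero    = 1
rise n (suc j) = suc n * rise (suc n) j

rise-last : ∀ n j → rise n (suc j) ≡ (n + suc j) * rise n j
rise-last n zero    = cong (_* 1) (ℕP.+-comm 1 n)
rise-last n (suc j) = begin
  suc n * rise (suc n) (suc j)         ≡⟨ cong (suc n *_) (rise-last (suc n) j) ⟩
  suc n * ((suc n + suc j) * r)        ≡⟨ x∙yz≈y∙xz (suc n) (suc n + suc j) r ⟩
  (suc n + suc j) * (suc n * r)        ≡⟨ cong (_* (suc n * r)) (sym (ℕP.+-suc n (suc j))) ⟩
  (n + suc (suc j)) * rise n (suc j)   ∎
  where open ≡-Reasoning
        r = rise (suc n) j

rise-pascal : ∀ n j → rise (suc n) (suc j) ≡ suc j * rise (suc n) j + rise n (suc j)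
rise-pascal n j = begin
  rise (suc n) (suc j)                  ≡⟨ rise-last (suc n) j ⟩
  (suc n + suc j) * r                   ≡⟨ cong (_* r) (ℕP.+-comm (suc n) (suc j)) ⟩
  (suc j + suc n) * r                   ≡⟨ ℕP.*-distribʳ-+ r (suc j) (suc n) ⟩
  suc j * r + suc n * r                 ∎
  where open ≡-Reasoning
        r = rise (suc n) j

risingCoeffs : ℕ → ℕ → Poly → Poly
risingCoeffs j n []       = []
risingCoeffs j n (a ∷ as) = + rise n j ℤ.* a ∷ risingCoeffs j (suc n) as

risingCoeffs-zero : ∀ n l → risingCoeffs 0 n l ≡ l
risingCoeffs-zero n []       = refl
risingCoeffs-zero n (a ∷ as) = cong₂ _∷_ (ℤP.*-identityˡ a) (risingCoeffs-zero (suc n) as)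

derivAux-risingCoeffs : ∀ j n as →
  derivAux (suc n) (risingCoeffs j (suc n) as) ≡ risingCoeffs (suc j) n as
derivAux-risingCoeffs j n []       = refl
derivAux-risingCoeffs j n (a ∷ as) =
  cong₂ _∷_ (trans (sym (ℤP.*-assoc (+ suc n) (+ rise (suc n) j) a))
                   (cong (ℤ._* a) (sym (ℤP.pos-* (suc n) (rise (suc n) j)))))
            (derivAux-risingCoeffs j (suc n) as)

drop-suc : ∀ j (g : Poly) → drop (suc j) g ≡ drop 1 (drop j g)
drop-suc zero    g        = refl
drop-suc (suc j) []       = refl
drop-suc (suc j) (a ∷ as) = drop-suc j as

derivⁱ-closed : ∀ j g → derivⁱ j g ≡ risingCoeffs j 0 (drop j g)
derivⁱ-closed zero    g = sym (risingCoeffs-zero 0 g)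
derivⁱ-closed (suc j) g = begin
  deriv (derivⁱ j g)                         ≡⟨ cong deriv (derivⁱ-closed j g) ⟩
  deriv (risingCoeffs j 0 (drop j g))        ≡⟨ deriv-step (drop j g) ⟩
  risingCoeffs (suc j) 0 (drop 1 (drop j g)) ≡⟨ cong (risingCoeffs (suc j) 0) (sym (drop-suc j g)) ⟩
  risingCoeffs (suc j) 0 (drop (suc j) g)    ∎
  where
  open ≡-Reasoning
  deriv-step : ∀ l → deriv (risingCoeffs j 0 l) ≡ risingCoeffs (suc j) 0 (drop 1 l)
  deriv-step []       = refl
  deriv-step (a ∷ as) = derivAux-risingCoeffs j 0 as

eval-rising-pascal : ∀ j n l z →
  eval (risingCoeffs (suc j) (suc n) l) z
    ≡ + suc j ℤ.* eval (risingCoeffs j (suc n) l) z ℤ.+ eval (risingCoeffs (suc j) n l) z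
eval-rising-pascal j n []       z = sym (cong (ℤ._+ 0ℤ) (ℤP.*-zeroʳ (+ suc j)))
eval-rising-pascal j n (a ∷ as) z = begin
  + rise (suc n) (suc j) ℤ.* a ℤ.+ z ℤ.* eval (risingCoeffs (suc j) (suc (suc n)) as) z
    ≡⟨ cong₂ (λ c e → c ℤ.* a ℤ.+ z ℤ.* e) coefficient (eval-rising-pascal j (suc n) as z) ⟩
  (+ suc j ℤ.* + rise (suc n) j ℤ.+ + rise n (suc j)) ℤ.* a
    ℤ.+ z ℤ.* (+ suc j ℤ.* eval (risingCoeffs j (suc (suc n)) as) z
               ℤ.+ eval (risingCoeffs (suc j) (suc n) as) z)
    ≡⟨ regroup (+ suc j) (+ rise (suc n) j) (+ rise n (suc j)) a z _ _ ⟩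
  + suc j ℤ.* (+ rise (suc n) j ℤ.* a ℤ.+ z ℤ.* eval (risingCoeffs j (suc (suc n)) as) z)
    ℤ.+ (+ rise n (suc j) ℤ.* a ℤ.+ z ℤ.* eval (risingCoeffs (suc j) (suc n) as) z)
    ∎
  where
  open ≡-Reasoning
  coefficient : + rise (suc n) (suc j) ≡ + suc j ℤ.* + rise (suc n) j ℤ.+ + rise n (suc j)
  coefficient = trans (cong +_ (rise-pascal n j))
    (trans (ℤP.pos-+ (suc j * rise (suc n) j) (rise n (suc j)))
           (cong (ℤ._+ + rise n (suc j)) (ℤP.pos-* (suc j) (rise (suc n) j))))
  regroup : ∀ (c r s a z e₁ e₂ : ℤ) →
    (c ℤ.* r ℤ.+ s) ℤ.* a ℤ.+ z ℤ.* (c ℤ.* e₁ ℤ.+ e₂)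
      ≡ c ℤ.* (r ℤ.* a ℤ.+ z ℤ.* e₁) ℤ.+ (s ℤ.* a ℤ.+ z ℤ.* e₂)
  regroup = solve-∀

-- The recursion of taylor, read off from the closed form of derivⁱ.
eval-rising-step : ∀ j l z →
  eval (risingCoeffs (suc j) 0 l) z
    ≡ + suc j ℤ.* eval (risingCoeffs j 0 l) z ℤ.+ z ℤ.* eval (risingCoeffs (suc j) 0 (drop 1 l)) z
eval-rising-step j []       z = sym (cong₂ ℤ._+_ (ℤP.*-zeroʳ (+ suc j)) (ℤP.*-zeroʳ z))
eval-rising-step j (b ∷ bs) z = begin
  + rise 0 (suc j) ℤ.* b ℤ.+ z ℤ.* eval (risingCoeffs (suc j) 1 bs) z
    ≡⟨ cong₂ (λ c e → c ℤ.* b ℤ.+ z ℤ.* e)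
             (trans (cong +_ (rise-last 0 j)) (ℤP.pos-* (suc j) (rise 0 j)))
             (eval-rising-pascal j 0 bs z) ⟩
  (+ suc j ℤ.* + rise 0 j) ℤ.* b ℤ.+ z ℤ.* (+ suc j ℤ.* e₁ ℤ.+ e₂)
    ≡⟨ regroup (+ suc j) (+ rise 0 j) b z e₁ e₂ ⟩
  + suc j ℤ.* (+ rise 0 j ℤ.* b ℤ.+ z ℤ.* e₁) ℤ.+ z ℤ.* e₂
    ∎
  where
  open ≡-Reasoning
  e₁ = eval (risingCoeffs j 1 bs) z
  e₂ = eval (risingCoeffs (suc j) 0 bs) z
  regroup : ∀ (c r b z e₁ e₂ : ℤ) →
    (c ℤ.* r) ℤ.* b ℤ.+ z ℤ.* (c ℤ.* e₁ ℤ.+ e₂) ≡ c ℤ.* (r ℤ.* b ℤ.+ z ℤ.* e₁) ℤ.+ z ℤ.* e₂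
  regroup = solve-∀

eval-derivⁱ : ∀ j g z → eval (derivⁱ j g) z ≡ + (j !) ℤ.* taylor g j z
eval-derivⁱ j g z = trans (cong (λ h → eval h z) (derivⁱ-closed j g)) (closed j g)
  where
  open ≡-Reasoning
  closed : ∀ j g → eval (risingCoeffs j 0 (drop j g)) z ≡ + (j !) ℤ.* taylor g j z
  closed zero    []       = refl
  closed (suc j) []       = sym (ℤP.*-zeroʳ (+ (suc j !)))
  closed zero    g@(_ ∷ _) = trans (cong (λ h → eval h z) (risingCoeffs-zero 0 g))
                                   (trans (sym (taylor-zero g z)) (sym (ℤP.*-identityˡ _)))
  closed (suc j) (a ∷ as) = begin
    eval (risingCoeffs (suc j) 0 (drop j as)) z
      ≡⟨ eval-rising-step j (drop j as) z ⟩
    + suc j ℤ.* eval (risingCoeffs j 0 (drop j as)) z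
      ℤ.+ z ℤ.* eval (risingCoeffs (suc j) 0 (drop 1 (drop j as))) z
      ≡⟨ cong₂ (λ u v → + suc j ℤ.* u ℤ.+ z ℤ.* v)
               (closed j as)
               (trans (cong (λ h → eval (risingCoeffs (suc j) 0 h) z) (sym (drop-suc j as)))
                      (closed (suc j) as)) ⟩
    + suc j ℤ.* (+ (j !) ℤ.* taylor as j z) ℤ.+ z ℤ.* (+ (suc j !) ℤ.* taylor as (suc j) z)
      ≡⟨ cong (λ c → + suc j ℤ.* (+ (j !) ℤ.* taylor as j z) ℤ.+ z ℤ.* (c ℤ.* taylor as (suc j) z))
              (ℤP.pos-* (suc j) (j !)) ⟩
    + suc j ℤ.* (+ (j !) ℤ.* taylor as j z) ℤ.+ z ℤ.* ((+ suc j ℤ.* + (j !)) ℤ.* taylor as (suc j) z)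
      ≡⟨ regroup (+ suc j) (+ (j !)) (taylor as j z) z (taylor as (suc j) z) ⟩
    (+ suc j ℤ.* + (j !)) ℤ.* (taylor as j z ℤ.+ z ℤ.* taylor as (suc j) z)
      ≡⟨ cong (ℤ._* taylor (a ∷ as) (suc j) z) (sym (ℤP.pos-* (suc j) (j !))) ⟩
    + (suc j !) ℤ.* taylor (a ∷ as) (suc j) z
      ∎
    where
    regroup : ∀ (c f t z t′ : ℤ) →
      c ℤ.* (f ℤ.* t) ℤ.+ z ℤ.* ((c ℤ.* f) ℤ.* t′) ≡ (c ℤ.* f) ℤ.* (t ℤ.+ z ℤ.* t′)
    regroup = solve-∀

-- Exact division: (x·d) /ℕ d ≡ x.  The remainder r = (x - q)·d of x·d lies
-- in [0, d), which forces x = q.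
/ℕ-exact : ∀ d .{{_ : NonZero d}} x → (x ℤ.* + d) /ℕ d ≡ x
/ℕ-exact d x = sym (ℤP.i-j≡0⇒i≡j x q (ℤP.∣i∣≡0⇒i≡0 (small ∣x-q∣ r≡∣x-q∣*d (n%ℕd<d (x ℤ.* + d) d))))
  where
  q = (x ℤ.* + d) /ℕ d
  r = (x ℤ.* + d) %ℕ d
  ∣x-q∣ = ℤ.∣ x ℤ.- q ∣
  r≡[x-q]*d : + r ≡ (x ℤ.- q) ℤ.* + d
  r≡[x-q]*d = begin
    + r                                   ≡⟨ cancel (+ r) q (+ d) ⟩
    (+ r ℤ.+ q ℤ.* + d) ℤ.- q ℤ.* + d     ≡⟨ cong (ℤ._- q ℤ.* + d) (sym (a≡a%ℕn+[a/ℕn]*n (x ℤ.* + d) d)) ⟩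
    x ℤ.* + d ℤ.- q ℤ.* + d               ≡⟨ factor x q (+ d) ⟩
    (x ℤ.- q) ℤ.* + d                     ∎
    where
    open ≡-Reasoning
    cancel : ∀ (r q d : ℤ) → r ≡ (r ℤ.+ q ℤ.* d) ℤ.- q ℤ.* d
    cancel = solve-∀
    factor : ∀ (x q d : ℤ) → x ℤ.* d ℤ.- q ℤ.* d ≡ (x ℤ.- q) ℤ.* d
    factor = solve-∀
  r≡∣x-q∣*d : r ≡ ∣x-q∣ * d
  r≡∣x-q∣*d = trans (cong ℤ.∣_∣ r≡[x-q]*d) (ℤP.abs-* (x ℤ.- q) (+ d))
  small : ∀ m → r ≡ m * d → r < d → m ≡ 0
  small zero    _ _   = refl
  small (suc m) e r<d = ⊥-elim (ℕP.<⇒≱ r<d (subst (d ≤_) (sym e) (ℕP.m≤m+n d (m * d))))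

divZ-exact : ∀ m {a} x → 0 < m → a ≡ x ℤ.* + m → divZ m a ≡ x
divZ-exact (suc m) x _ refl = /ℕ-exact (suc m) x

hasse≡taylor : ∀ g j z → hasse g j z ≡ taylor g j z
hasse≡taylor g j z = divZ-exact (j !) (taylor g j z) (ℕP.1≤n! j)
  (trans (eval-derivⁱ j g z) (ℤP.*-comm (+ (j !)) (taylor g j z)))


coef : Poly → ℕ → ℤ
coef []       n       = 0ℤ
coef (a ∷ as) zero    = a
coef (a ∷ as) (suc n) = coef as n

coef-+ₚ : ∀ g h n → coef (g +ₚ h) n ≡ coef g n ℤ.+ coef h n
coef-+ₚ []       h        n       = sym (ℤP.+-identityˡ _)
coef-+ₚ (a ∷ as) []       n       = sym (ℤP.+-identityʳ _)
coef-+ₚ (a ∷ as) (b ∷ bs) zero    = refl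
coef-+ₚ (a ∷ as) (b ∷ bs) (suc n) = coef-+ₚ as bs n

coef-map : ∀ (h : ℤ → ℤ) → h 0ℤ ≡ 0ℤ → ∀ g n → coef (map h g) n ≡ h (coef g n)
coef-map h h0 []       n       = sym h0
coef-map h h0 (a ∷ as) zero    = refl
coef-map h h0 (a ∷ as) (suc n) = coef-map h h0 as n

coef-scale : ∀ c g n → coef (scale c g) n ≡ c ℤ.* coef g n
coef-scale c = coef-map (c ℤ.*_) (ℤP.*-zeroʳ c)

coef-drop : ∀ n g i → coef (drop n g) i ≡ coef g (n + i)
coef-drop zero    g        i = refl
coef-drop (suc n) []       i = refl
coef-drop (suc n) (a ∷ as) i = coef-drop n as i

linear : ℕ → ℕ → Poly
linear z p = + z ∷ + p ∷ []

coef-linear-mul-zero : ∀ z p c → coef (linear z p *ₚ c) 0 ≡ + z ℤ.* coef c 0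
coef-linear-mul-zero z p c =
  trans (coef-+ₚ (scale (+ z) c) (0ℤ ∷ (scale (+ p) c +ₚ (0ℤ ∷ []))) 0)
        (trans (ℤP.+-identityʳ _) (coef-scale (+ z) c 0))

coef-linear-mul-suc : ∀ z p c n →
  coef (linear z p *ₚ c) (suc n) ≡ + z ℤ.* coef c (suc n) ℤ.+ + p ℤ.* coef c n
coef-linear-mul-suc z p c n = begin
  coef (scale (+ z) c +ₚ higher) (suc n)
    ≡⟨ coef-+ₚ (scale (+ z) c) higher (suc n) ⟩
  coef (scale (+ z) c) (suc n) ℤ.+ coef (scale (+ p) c +ₚ (0ℤ ∷ [])) n
    ≡⟨ cong₂ ℤ._+_ (coef-scale (+ z) c (suc n)) (coef-+ₚ (scale (+ p) c) (0ℤ ∷ []) n) ⟩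
  + z ℤ.* coef c (suc n) ℤ.+ (coef (scale (+ p) c) n ℤ.+ coef (0ℤ ∷ []) n)
    ≡⟨ cong (ℤ._+_ (+ z ℤ.* coef c (suc n))) (cong₂ ℤ._+_ (coef-scale (+ p) c n) (coef-zero n)) ⟩
  + z ℤ.* coef c (suc n) ℤ.+ (+ p ℤ.* coef c n ℤ.+ 0ℤ)
    ≡⟨ cong (ℤ._+_ (+ z ℤ.* coef c (suc n))) (ℤP.+-identityʳ (+ p ℤ.* coef c n)) ⟩
  + z ℤ.* coef c (suc n) ℤ.+ + p ℤ.* coef c n
    ∎
  where
  open ≡-Reasoning
  higher = 0ℤ ∷ (scale (+ p) c +ₚ (0ℤ ∷ []))
  coef-zero : ∀ n → coef (0ℤ ∷ []) n ≡ 0ℤ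
  coef-zero zero    = refl
  coef-zero (suc n) = refl

coef-compose-linear : ∀ g z p j →
  coef (compose g (linear z p)) j ≡ + (p ^ j) ℤ.* taylor g j (+ z)
coef-compose-linear []       z p j       = sym (ℤP.*-zeroʳ (+ (p ^ j)))
coef-compose-linear (a ∷ as) z p zero    = begin
  coef (compose (a ∷ as) (linear z p)) 0
    ≡⟨ coef-+ₚ (a ∷ []) (linear z p *ₚ compose as (linear z p)) 0 ⟩
  a ℤ.+ coef (linear z p *ₚ compose as (linear z p)) 0
    ≡⟨ cong (λ t → a ℤ.+ t) (coef-linear-mul-zero z p (compose as (linear z p))) ⟩
  a ℤ.+ + z ℤ.* coef (compose as (linear z p)) 0
    ≡⟨ cong (λ c → a ℤ.+ + z ℤ.* c) (coef-compose-linear as z p 0) ⟩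
  a ℤ.+ + z ℤ.* (+ 1 ℤ.* taylor as 0 (+ z))
    ≡⟨ regroup a (+ z) (taylor as 0 (+ z)) ⟩
  + 1 ℤ.* taylor (a ∷ as) 0 (+ z)
    ∎
  where
  open ≡-Reasoning
  regroup : ∀ (a z t : ℤ) → a ℤ.+ z ℤ.* (+ 1 ℤ.* t) ≡ + 1 ℤ.* (a ℤ.+ z ℤ.* t)
  regroup = solve-∀
coef-compose-linear (a ∷ as) z p (suc j) = begin
  coef (compose (a ∷ as) (linear z p)) (suc j)
    ≡⟨ coef-+ₚ (a ∷ []) (linear z p *ₚ compose as (linear z p)) (suc j) ⟩
  coef (a ∷ []) (suc j) ℤ.+ coef (linear z p *ₚ compose as (linear z p)) (suc j)
    ≡⟨ cong (λ t → 0ℤ ℤ.+ t) (coef-linear-mul-suc z p (compose as (linear z p)) j) ⟩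
  0ℤ ℤ.+ (+ z ℤ.* coef (compose as (linear z p)) (suc j) ℤ.+ + p ℤ.* coef (compose as (linear z p)) j)
    ≡⟨ cong₂ (λ u v → 0ℤ ℤ.+ (+ z ℤ.* u ℤ.+ + p ℤ.* v))
             (trans (coef-compose-linear as z p (suc j)) (cong (ℤ._* _) (ℤP.pos-* p (p ^ j))))
             (coef-compose-linear as z p j) ⟩
  0ℤ ℤ.+ (+ z ℤ.* ((+ p ℤ.* + (p ^ j)) ℤ.* taylor as (suc j) (+ z))
          ℤ.+ + p ℤ.* (+ (p ^ j) ℤ.* taylor as j (+ z)))
    ≡⟨ regroup (+ z) (+ p) (+ (p ^ j)) (taylor as j (+ z)) (taylor as (suc j) (+ z)) ⟩
  (+ p ℤ.* + (p ^ j)) ℤ.* taylor (a ∷ as) (suc j) (+ z)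
    ≡⟨ cong (ℤ._* _) (sym (ℤP.pos-* p (p ^ j))) ⟩
  + (p ^ suc j) ℤ.* taylor (a ∷ as) (suc j) (+ z)
    ∎
  where
  open ≡-Reasoning
  regroup : ∀ (z p q t t′ : ℤ) →
    0ℤ ℤ.+ (z ℤ.* ((p ℤ.* q) ℤ.* t′) ℤ.+ p ℤ.* (q ℤ.* t)) ≡ (p ℤ.* q) ℤ.* (t ℤ.+ z ℤ.* t′)
  regroup = solve-∀

isZeroPoly-true : ∀ l → (∀ m → coef l m ≡ 0ℤ) → isZeroPoly l ≡ true
isZeroPoly-true []       zeros = refl
isZeroPoly-true (a ∷ as) zeros with zeros 0
... | refl = isZeroPoly-true as (λ m → zeros (suc m))

isZeroPoly-false : ∀ l m → coef l m ≢ 0ℤ → isZeroPoly l ≡ false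
isZeroPoly-false []       m       nz = ⊥-elim (nz refl)
isZeroPoly-false (a ∷ as) m       nz with a ℤ.≟ 0ℤ
isZeroPoly-false (a ∷ as) m       nz | no _    = refl
isZeroPoly-false (a ∷ as) zero    nz | yes a≡0 = ⊥-elim (nz a≡0)
isZeroPoly-false (a ∷ as) (suc m) nz | yes _   = isZeroPoly-false as m nz

deg-≥ : ∀ l m → coef l m ≢ 0ℤ → m ≤ deg l
deg-≥ l        zero    nz = z≤n
deg-≥ []       (suc m) nz = ⊥-elim (nz refl)
deg-≥ (a ∷ as) (suc m) nz rewrite isZeroPoly-false as m nz = s≤s (deg-≥ as m nz)

deg-exact : ∀ l D → coef l D ≢ 0ℤ → (∀ m → D < m → coef l m ≡ 0ℤ) → deg l ≡ D
deg-exact []       D       nz zeros = ⊥-elim (nz refl)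
deg-exact (a ∷ as) zero    nz zeros rewrite isZeroPoly-true as (λ m → zeros (suc m) (s≤s z≤n)) = refl
deg-exact (a ∷ as) (suc D) nz zeros rewrite isZeroPoly-false as D nz =
  cong suc (deg-exact as D nz (λ m D<m → zeros (suc m) (s≤s D<m)))


-- quot g z is the quotient of g by x - z:  g = (x - z)·quot g z + g(z).
-- For g = a + x h one has quot g z = h(z) + x · quot h z.
quot : Poly → ℤ → Poly
quot []       z = []
quot (a ∷ as) z = eval as z ∷ quot as z

coef-quot : ∀ g z i → coef (quot g z) i ≡ eval (drop (suc i) g) z
coef-quot []       z i       = refl
coef-quot (a ∷ as) z zero    = refl
coef-quot (a ∷ as) z (suc i) = coef-quot as z i

taylor-quot-at : ∀ g z j → taylor (quot g z) j z ≡ taylor g (suc j) z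
taylor-quot-at []       z j       = refl
taylor-quot-at (a ∷ as) z zero    =
  cong₂ (λ u v → u ℤ.+ z ℤ.* v) (sym (taylor-zero as z)) (taylor-quot-at as z zero)
taylor-quot-at (a ∷ as) z (suc j) =
  cong₂ (λ u v → u ℤ.+ z ℤ.* v) (taylor-quot-at as z j) (taylor-quot-at as z (suc j))

-- The lower-order term in the Taylor expansion of (x - z)·quot g z + g(z)
-- at w: the constant g(z) for j = 0, the (j-1)-th coefficient of the
-- quotient otherwise.
lowerTerm : Poly → ℤ → ℤ → ℕ → ℤ
lowerTerm g z w zero    = eval g z
lowerTerm g z w (suc j) = taylor (quot g z) j w

lowerTerm-cons : ∀ a as z w j →
  lowerTerm (a ∷ as) z w (suc j) ≡ lowerTerm as z w j ℤ.+ w ℤ.* taylor (quot as z) j w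
lowerTerm-cons a as z w zero    = refl
lowerTerm-cons a as z w (suc j) = refl

taylor-quot : ∀ g z w j →
  taylor g j w ≡ (w ℤ.- z) ℤ.* taylor (quot g z) j w ℤ.+ lowerTerm g z w j
taylor-quot []       z w zero    = sym (trans (ℤP.+-identityʳ _) (ℤP.*-zeroʳ (w ℤ.- z)))
taylor-quot []       z w (suc j) = sym (trans (ℤP.+-identityʳ _) (ℤP.*-zeroʳ (w ℤ.- z)))
taylor-quot (a ∷ as) z w zero    = begin
  a ℤ.+ w ℤ.* taylor as 0 w
    ≡⟨ cong (λ t → a ℤ.+ w ℤ.* t) (taylor-quot as z w 0) ⟩
  a ℤ.+ w ℤ.* ((w ℤ.- z) ℤ.* taylor q 0 w ℤ.+ eval as z)
    ≡⟨ regroup a z w (taylor q 0 w) (eval as z) ⟩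
  (w ℤ.- z) ℤ.* (eval as z ℤ.+ w ℤ.* taylor q 0 w) ℤ.+ (a ℤ.+ z ℤ.* eval as z)
    ∎
  where
  open ≡-Reasoning
  q = quot as z
  regroup : ∀ (a z w t c : ℤ) →
    a ℤ.+ w ℤ.* ((w ℤ.- z) ℤ.* t ℤ.+ c) ≡ (w ℤ.- z) ℤ.* (c ℤ.+ w ℤ.* t) ℤ.+ (a ℤ.+ z ℤ.* c)
  regroup = solve-∀
taylor-quot (a ∷ as) z w (suc j) = begin
  taylor as j w ℤ.+ w ℤ.* taylor as (suc j) w
    ≡⟨ cong₂ (λ u v → u ℤ.+ w ℤ.* v) (taylor-quot as z w j) (taylor-quot as z w (suc j)) ⟩
  ((w ℤ.- z) ℤ.* taylor q j w ℤ.+ lowerTerm as z w j)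
    ℤ.+ w ℤ.* ((w ℤ.- z) ℤ.* taylor q (suc j) w ℤ.+ taylor q j w)
    ≡⟨ regroup (w ℤ.- z) w (taylor q j w) (taylor q (suc j) w) (lowerTerm as z w j) ⟩
  (w ℤ.- z) ℤ.* (taylor q j w ℤ.+ w ℤ.* taylor q (suc j) w)
    ℤ.+ (lowerTerm as z w j ℤ.+ w ℤ.* taylor q j w)
    ≡⟨ cong (ℤ._+_ ((w ℤ.- z) ℤ.* (taylor q j w ℤ.+ w ℤ.* taylor q (suc j) w))) (sym (lowerTerm-cons a as z w j)) ⟩
  (w ℤ.- z) ℤ.* taylor (quot (a ∷ as) z) (suc j) w ℤ.+ lowerTerm (a ∷ as) z w (suc j)
    ∎
  where
  open ≡-Reasoning
  q = quot as z
  regroup : ∀ (d w t t′ l : ℤ) →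
    (d ℤ.* t ℤ.+ l) ℤ.+ w ℤ.* (d ℤ.* t′ ℤ.+ t) ≡ d ℤ.* (t ℤ.+ w ℤ.* t′) ℤ.+ (l ℤ.+ w ℤ.* t)
  regroup = solve-∀


below-budget : ∀ {s κ} → 1 ≤ s → s ≤ κ ∸ 1 → s < κ
below-budget {suc s} {zero}  _ ()
below-budget {s}     {suc κ} _ s≤κ = s≤s s≤κ

half-≤ : ∀ a b → 2 * a ≤ b → a ≤ b / 2
half-≤ a b 2a≤b = ℕP.≤-trans (ℕP.≤-reflexive (sym (m*n/n≡m a 2)))
                             (/-monoˡ-≤ 2 (subst (_≤ b) (ℕP.*-comm 2 a) 2a≤b))

digits : ∀ {p z ζ ζ′} .{{_ : NonZero p}} → z < p → ζ ≡ z + p * ζ′ → ζ % p ≡ z × ζ / p ≡ ζ′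
digits {p} {z} {ζ} {ζ′} z<p ζ≡ = last , rest
  where
  ζ≡′ : ζ ≡ z + ζ′ * p
  ζ≡′ = trans ζ≡ (cong (_+_ z) (ℕP.*-comm p ζ′))
  last : ζ % p ≡ z
  last = trans (cong (_% p) ζ≡′) (trans ([m+kn]%n≡m%n z ζ′ p) (m<n⇒m%n≡m z<p))
  rest : ζ / p ≡ ζ′
  rest = ℕP.*-cancelʳ-≡ (ζ / p) ζ′ p (ℕP.+-cancelˡ-≡ z _ _ (begin
    z + ζ / p * p        ≡⟨ cong (_+ ζ / p * p) (sym last) ⟩
    ζ % p + ζ / p * p    ≡⟨ sym (m≡m%n+[m/n]*n ζ p) ⟩
    ζ                    ≡⟨ ζ≡′ ⟩
    z + ζ′ * p           ∎))
    where open ≡-Reasoning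


map-Unique : ∀ {A B : Set} {P : A → Set} (f : A → B) → (∀ {x y} → P x → P y → f x ≡ f y → x ≡ y) →
             ∀ {xs} → All P xs → Unique xs → Unique (map f xs)
map-Unique f inj {[]}     []         []           = []
map-Unique {P = P} f inj {x ∷ xs} (px ∷ pxs) (x∉xs ∷ uniq) = apart pxs x∉xs ∷ map-Unique f inj pxs uniq
  where
  apart : ∀ {ys} → All P ys → All (x ≢_) ys → All (f x ≢_) (map f ys)
  apart []         []           = []
  apart (py ∷ pys) (x≢y ∷ x∉ys) = (λ eq → x≢y (inj px py eq)) ∷ apart pys x∉ys

Unique-constant : ∀ {A : Set} {c : A} xs → All (_≡ c) xs → Unique xs → length xs ≤ 1
Unique-constant []           _                _               = z≤n
Unique-constant (x ∷ [])     _                _               = s≤s z≤n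
Unique-constant (x ∷ y ∷ ys) (x≡c ∷ y≡c ∷ _) ((x≢y ∷ _) ∷ _) = ⊥-elim (x≢y (trans x≡c (sym y≡c)))

module ByKey {A : Set} (key : A → ℕ) where

  group : ℕ → List A → List A
  group b = filter (λ x → key x ℕP.≟ b)

  countBelow : ℕ → List A → ℕ
  countBelow zero    xs = 0
  countBelow (suc B) xs = countBelow B xs + length (group B xs)

  countBelow-skip : ∀ B x xs → B ≤ key x → countBelow B (x ∷ xs) ≡ countBelow B xs
  countBelow-skip zero    x xs _     = refl
  countBelow-skip (suc B) x xs B<key = cong₂ _+_ (countBelow-skip B x xs (ℕP.<⇒≤ B<key))
    (cong length (filter-reject (λ y → key y ℕP.≟ B) (λ eq → ℕP.<-irrefl (sym eq) B<key)))

  countBelow-hit : ∀ B x xs → key x < B → countBelow B (x ∷ xs) ≡ suc (countBelow B xs)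
  countBelow-hit (suc B) x xs key<B with key x ℕP.≟ B
  ... | yes key≡B = begin
    countBelow B (x ∷ xs) + length (group B (x ∷ xs))
      ≡⟨ cong₂ _+_ (countBelow-skip B x xs (ℕP.≤-reflexive (sym key≡B)))
                   (cong length (filter-accept (λ y → key y ℕP.≟ B) key≡B)) ⟩
    countBelow B xs + suc (length (group B xs))         ≡⟨ ℕP.+-suc (countBelow B xs) _ ⟩
    suc (countBelow B xs + length (group B xs))         ∎
    where open ≡-Reasoning
  ... | no key≢B = cong₂ _+_ (countBelow-hit B x xs (ℕP.≤∧≢⇒< (ℕP.≤-pred key<B) key≢B))
    (cong length (filter-reject (λ y → key y ℕP.≟ B) key≢B))

  length-by-groups : ∀ B xs → All (λ x → key x < B) xs → length xs ≡ countBelow B xs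
  length-by-groups B []       []            = sym (zeros B)
    where
    zeros : ∀ B → countBelow B [] ≡ 0
    zeros zero    = refl
    zeros (suc B) = cong (_+ 0) (zeros B)
  length-by-groups B (x ∷ xs) (key<B ∷ keys) =
    trans (cong suc (length-by-groups B xs keys)) (sym (countBelow-hit B x xs key<B))

  group-key : ∀ b xs → All (λ x → key x ≡ b) (group b xs)
  group-key b = AllP.all-filter (λ x → key x ℕP.≟ b)

  group-All : ∀ {P : A → Set} b {xs} → All P xs → All P (group b xs)
  group-All b = AllP.filter⁺ (λ x → key x ℕP.≟ b)

  group-Unique : ∀ b {xs} → Unique xs → Unique (group b xs)
  group-Unique b = UniqueP.filter⁺ (λ x → key x ℕP.≟ b)


module Shape (p : ℕ) where

  -- Budget invariant: every edge spends s ≥ 2 of the initial budget k.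
  budget : ∀ {k f i ζ g κ} → Node p k f i ζ g κ → 2 * i + κ ≤ k
  budget root = ℕP.≤-refl
  budget {k} (child {i} {κ = κ} node z s (_ , _ , 2≤s , s≤κ∸1)) = begin
    2 * suc i + (κ ∸ s)       ≡⟨ cong (_+ (κ ∸ s)) (ℕP.*-suc 2 i) ⟩
    2 + 2 * i + (κ ∸ s)       ≤⟨ ℕP.+-monoˡ-≤ (κ ∸ s) (ℕP.+-monoˡ-≤ (2 * i) 2≤s) ⟩
    s + 2 * i + (κ ∸ s)       ≡⟨ cong (_+ (κ ∸ s)) (ℕP.+-comm s (2 * i)) ⟩
    2 * i + s + (κ ∸ s)       ≡⟨ ℕP.+-assoc (2 * i) s (κ ∸ s) ⟩
    2 * i + (s + (κ ∸ s))     ≡⟨ cong (_+_ (2 * i)) (ℕP.m+[n∸m]≡n (ℕP.<⇒≤ s<κ)) ⟩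
    2 * i + κ                 ≤⟨ budget node ⟩
    k                         ∎
    where
    open ℕP.≤-Reasoning
    s<κ = below-budget (ℕP.<-trans (s≤s z≤n) 2≤s) s≤κ∸1

  κ≤k : ∀ {k f i ζ g κ} → Node p k f i ζ g κ → κ ≤ k
  κ≤k {i = i} {κ = κ} node = ℕP.≤-trans (ℕP.m≤n+m κ (2 * i)) (budget node)

  -- Part (1): the depth is at most ⌊(k-1)/2⌋, since a non-root node keeps a
  -- positive budget κ - s.
  depth-bound : ∀ {k f i ζ g κ} → Node p k f i ζ g κ → i ≤ (k ∸ 1) / 2
  depth-bound root = z≤n
  depth-bound {k} node@(child {i} {κ = κ} _ z s (_ , _ , 2≤s , s≤κ∸1)) =
    half-≤ (suc i) (k ∸ 1) (ℕP.m+n≤o⇒m≤o∸n (2 * suc i)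
      (ℕP.≤-trans (ℕP.+-monoʳ-≤ (2 * suc i) 0<κ∸s) (budget node)))
    where
    0<κ∸s : 1 ≤ κ ∸ s
    0<κ∸s = ℕP.m<n⇒0<n∸m (below-budget (ℕP.<-trans (s≤s z≤n) 2≤s) s≤κ∸1)

  root-unique : ∀ {k f ζ g κ} → Node p k f 0 ζ g κ → ζ ≡ 0
  root-unique root = refl

  descend : ∀ {k f i ζ g κ} → Node p k f (suc i) ζ g κ →
            Σ ℕ λ z → Σ ℕ λ s → ChildCond p f k z s ×
            Σ ℕ λ ζ′ → ζ ≡ z + p * ζ′ × Node p (k ∸ s) (childPoly p f k z s) i ζ′ g κ
  descend (child root z s cc) = z , s , cc , 0 , ζ≡ , root
    where
    ζ≡ : 0 + 1 * z ≡ z + p * 0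
    ζ≡ = trans (ℕP.*-identityˡ z) (sym (trans (cong (_+_ z) (ℕP.*-zeroʳ p)) (ℕP.+-identityʳ z)))
  descend (child {suc i} {μ} node z s cc) with descend node
  ... | z₀ , s₀ , cc₀ , ζ′ , μ≡ , node′ = z₀ , s₀ , cc₀ , ζ′ + p ^ i * z , ζ≡ , child node′ z s cc
    where
    ζ≡ : μ + p * p ^ i * z ≡ z₀ + p * (ζ′ + p ^ i * z)
    ζ≡ = begin
      μ + p * p ^ i * z                 ≡⟨ cong₂ _+_ μ≡ (ℕP.*-assoc p (p ^ i) z) ⟩
      z₀ + p * ζ′ + p * (p ^ i * z)     ≡⟨ ℕP.+-assoc z₀ (p * ζ′) (p * (p ^ i * z)) ⟩
      z₀ + (p * ζ′ + p * (p ^ i * z))   ≡⟨ cong (_+_ z₀) (sym (ℕP.*-distribˡ-+ p ζ′ (p ^ i * z))) ⟩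
      z₀ + p * (ζ′ + p ^ i * z)         ∎
      where open ≡-Reasoning


module ModP (p : ℕ) (p-prime : Prime p) where

  instance
    p≢0 : NonZero p
    p≢0 = prime⇒nonZero p-prime

  Dvd : ℤ → Set
  Dvd a = + p ℤS.∣ a

  euclid : ∀ a b → Dvd (a ℤ.* b) → Dvd a ⊎ Dvd b
  euclid a b d = Sum.map ∣ᵤ⇒∣ ∣ᵤ⇒∣
    (euclidsLemma ℤ.∣ a ∣ ℤ.∣ b ∣ p-prime (subst (p ℕD.∣_) (ℤP.abs-* a b) (∣⇒∣ᵤ d)))

  ¬p∣gap : ∀ {m n} → m < n → n < p → ¬ p ℕD.∣ (n ∸ m)
  ¬p∣gap {m} {n} m<n n<p d =
    ℕP.<⇒≱ (ℕP.≤-<-trans (ℕP.m∸n≤m n m) n<p) (ℕD.∣⇒≤ {{>-nonZero (ℕP.m<n⇒0<n∸m m<n)}} d)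

  distinct-residues : ∀ {z z′} → z < p → z′ < p → z ≢ z′ → ¬ Dvd (+ z′ ℤ.- + z)
  distinct-residues {z} {z′} z<p z′<p z≢z′ d with ℕP.<-cmp z z′
  ... | tri< z<z′ _ _ = ¬p∣gap z<z′ z′<p (subst (p ℕD.∣_) gap (∣⇒∣ᵤ d))
    where
    gap : ℤ.∣ + z′ ℤ.- + z ∣ ≡ z′ ∸ z
    gap = trans (cong ℤ.∣_∣ (ℤP.m-n≡m⊖n z′ z)) (trans (ℤP.∣m⊖n∣≡∣n⊖m∣ z′ z) (ℤP.∣⊖∣-≤ (ℕP.<⇒≤ z<z′)))
  ... | tri≈ _ z≡z′ _ = z≢z′ z≡z′
  ... | tri> _ _ z′<z = ¬p∣gap z′<z z<p (subst (p ℕD.∣_) gap (∣⇒∣ᵤ d))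
    where
    gap : ℤ.∣ + z′ ℤ.- + z ∣ ≡ z ∸ z′
    gap = trans (cong ℤ.∣_∣ (ℤP.m-n≡m⊖n z′ z)) (ℤP.∣⊖∣-≤ (ℕP.<⇒≤ z′<z))

  p∣0 : Dvd 0ℤ
  p∣0 = divides 0ℤ refl

  -- DegModP g D: the reduction of g modulo p has degree exactly D.
  DegModP : Poly → ℕ → Set
  DegModP g D = ¬ Dvd (coef g D) × (∀ m → D < m → Dvd (coef g m))

  eval-Dvd : ∀ g z → (∀ i → Dvd (coef g i)) → Dvd (eval g z)
  eval-Dvd []       z all = p∣0
  eval-Dvd (a ∷ as) z all = ℤS.∣m∣n⇒∣m+n (all 0) (ℤS.∣n⇒∣m*n z (eval-Dvd as z (λ i → all (suc i))))

  eval-drop-Dvd : ∀ g D n z → (∀ m → D < m → Dvd (coef g m)) → D < n → Dvd (eval (drop n g) z)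
  eval-drop-Dvd g D n z high D<n = eval-Dvd (drop n g) z λ i →
    subst Dvd (sym (coef-drop n g i)) (high (n + i) (ℕP.<-≤-trans D<n (ℕP.m≤m+n n i)))

  -- If every coefficient above D is divisible, then the tail starting at D
  -- is congruent to its leading coefficient; in particular divisibility of
  -- its value forces divisibility of that coefficient.
  top-coef-Dvd : ∀ g D z → (∀ m → D < m → Dvd (coef g m)) → Dvd (eval (drop D g) z) → Dvd (coef g D)
  top-coef-Dvd []       D       z high d = p∣0
  top-coef-Dvd (a ∷ as) zero    z high d =
    ℤS.∣m+n∣n⇒∣m d (ℤS.∣n⇒∣m*n z (eval-Dvd as z (λ i → high (suc i) (s≤s z≤n))))
  top-coef-Dvd (a ∷ as) (suc D) z high d = top-coef-Dvd as D z (λ m D<m → high (suc m) (s≤s D<m)) d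

  -- Dividing by x - z at a root z of g modulo p lowers the degree by one.
  -- (Degree 0 is impossible, as the value would be the unit leading term.)
  quot-DegModP : ∀ g D z → DegModP g D → Dvd (eval g z) →
                 Σ ℕ λ D′ → D ≡ suc D′ × DegModP (quot g z) D′
  quot-DegModP g zero     z (top , high) g[z] = ⊥-elim (top (top-coef-Dvd g 0 z high g[z]))
  quot-DegModP g (suc D′) z (top , high) _    = D′ , refl , top′ , high′
    where
    top′ : ¬ Dvd (coef (quot g z) D′)
    top′ d = top (top-coef-Dvd g (suc D′) z high (subst Dvd (coef-quot g z D′) d))
    high′ : ∀ m → D′ < m → Dvd (coef (quot g z) m)
    high′ m D′<m = subst Dvd (sym (coef-quot g z m)) (eval-drop-Dvd g (suc D′) (suc m) z high (s≤s D′<m))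

  -- RootMult g z s: z is a root of g modulo p of multiplicity at least s,
  -- i.e. the first s Taylor coefficients of g at z vanish modulo p.
  RootMult : Poly → ℕ → ℕ → Set
  RootMult g z s = ∀ j → j < s → Dvd (taylor g j (+ z))

  RootMult-root : ∀ g z {s} → RootMult g z (suc s) → Dvd (eval g (+ z))
  RootMult-root g z mult = subst Dvd (taylor-zero g (+ z)) (mult 0 (s≤s z≤n))

  RootMult-quot : ∀ g z {s} → RootMult g z (suc s) → RootMult (quot g (+ z)) z s
  RootMult-quot g z mult j j<s = subst Dvd (sym (taylor-quot-at g (+ z) j)) (mult (suc j) (s≤s j<s))

  quot-RootMult : ∀ {g z z′ s} → z < p → z′ < p → z ≢ z′ → Dvd (eval g (+ z)) →
                  RootMult g z′ s → RootMult (quot g (+ z)) z′ s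
  quot-RootMult {g} {z} {z′} {s} z<p z′<p z≢z′ g[z] mult = go
    where
    -- By taylor-quot, the vanishing of the other terms leaves (z′ - z)·t ≡ 0.
    strip : ∀ j → Dvd (lowerTerm g (+ z) (+ z′) j) → j < s → Dvd (taylor (quot g (+ z)) j (+ z′))
    strip j low j<s with euclid (+ z′ ℤ.- + z) (taylor (quot g (+ z)) j (+ z′))
                         (ℤS.∣m+n∣n⇒∣m (subst Dvd (taylor-quot g (+ z) (+ z′) j) (mult j j<s)) low)
    ... | inj₁ d = ⊥-elim (distinct-residues z<p z′<p z≢z′ d)
    ... | inj₂ d = d
    go : RootMult (quot g (+ z)) z′ s
    go zero    0<s  = strip zero g[z] 0<s
    go (suc j) sj<s = strip (suc j) (go j (ℕP.<-trans (ℕP.n<1+n j) sj<s)) sj<s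

  IsRoot : Poly → ℕ × ℕ → Set
  IsRoot g (z , s) = z < p × RootMult g z s

  -- The multiplicities of distinct roots of g modulo p add up to at most its
  -- degree modulo p.  Each unit of multiplicity of the first root is divided
  -- out in turn; this lowers the degree by one and keeps the other roots.
  multiplicities-bounded : ∀ zss g D → DegModP g D → Unique (map proj₁ zss) →
                           All (IsRoot g) zss → sum (map proj₂ zss) ≤ D
  multiplicities-bounded []                g D hasDeg []            []                    = z≤n
  multiplicities-bounded ((z , s) ∷ rest) g D hasDeg (z∉rest ∷ uniq) ((z<p , mult) ∷ roots) =
    peel s g D hasDeg mult roots
    where
    peel : ∀ s g D → DegModP g D → RootMult g z s → All (IsRoot g) rest → s + sum (map proj₂ rest) ≤ D
    peel zero    g D hasDeg mult roots = multiplicities-bounded rest g D hasDeg uniq roots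
    peel (suc s) g D hasDeg mult roots with quot-DegModP g D (+ z) hasDeg (RootMult-root g z mult)
    ... | D′ , refl , hasDeg′ =
      s≤s (peel s (quot g (+ z)) D′ hasDeg′ (RootMult-quot g z mult) (others (AllP.map⁻ z∉rest) roots))
      where
      others : ∀ {xs} → All (λ y → z ≢ proj₁ y) xs → All (IsRoot g) xs → All (IsRoot (quot g (+ z))) xs
      others []           []                   = []
      others (z≢z′ ∷ nes) ((z′<p , mult′) ∷ rs) =
        (z′<p , quot-RootMult {g} z<p z′<p z≢z′ (RootMult-root g z mult) mult′) ∷ others nes rs

  modZ-spec : ∀ M → 0 < M → ∀ a → Σ ℕ λ r → Σ ℤ λ Q →
              modZ M a ≡ + r × r < M × a ≡ + r ℤ.+ Q ℤ.* + M
  modZ-spec (suc M) _ a = a %ℕ suc M , a /ℕ suc M , refl , n%ℕd<d a (suc M) , a≡a%ℕn+[a/ℕn]*n a (suc M)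

  modZ-Dvd : ∀ M → 0 < M → p ℕD.∣ M → ∀ a → Dvd a → Dvd (modZ M a)
  modZ-Dvd M 0<M p∣M a d with modZ-spec M 0<M a
  ... | r , Q , eq , _ , a≡ = subst Dvd (sym eq) (ℤS.∣m+n∣n⇒∣m (subst Dvd a≡ d) (ℤS.∣n⇒∣m*n Q (∣ᵤ⇒∣ p∣M)))

  modZ-Dvd⁻ : ∀ M → 0 < M → p ℕD.∣ M → ∀ a → Dvd (modZ M a) → Dvd a
  modZ-Dvd⁻ M 0<M p∣M a d with modZ-spec M 0<M a
  ... | r , Q , eq , _ , a≡ = subst Dvd (sym a≡) (ℤS.∣m∣n⇒∣m+n (subst Dvd eq d) (ℤS.∣n⇒∣m*n Q (∣ᵤ⇒∣ p∣M)))

  0<p : 0 < p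
  0<p = >-nonZero⁻¹ p

  modZ-p-Dvd : ∀ a → Dvd a → modZ p a ≡ 0ℤ
  modZ-p-Dvd a d with modZ-spec p 0<p a | modZ-Dvd p 0<p ℕD.∣-refl a d
  ... | zero  , _ , eq , _   , _ | _  = eq
  ... | suc r , _ , eq , r<p , _ | d′ =
    ⊥-elim (ℕP.<⇒≱ r<p (ℕD.∣⇒≤ (∣⇒∣ᵤ (subst Dvd eq d′))))

  modZ-p-zero : ∀ a → modZ p a ≡ 0ℤ → Dvd a
  modZ-p-zero a eq = modZ-Dvd⁻ p 0<p ℕD.∣-refl a (subst Dvd (sym eq) p∣0)

  modZ-0 : ∀ M → modZ M 0ℤ ≡ 0ℤ
  modZ-0 zero    = refl
  modZ-0 (suc M) = refl

  reduce-deg : ∀ g D → DegModP g D → deg (reduce p g) ≡ D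
  reduce-deg g D (top , high) = deg-exact (reduce p g) D
    (λ eq → top (modZ-p-zero (coef g D) (trans (sym (coef-map (modZ p) (modZ-0 p) g D)) eq)))
    (λ m D<m → trans (coef-map (modZ p) (modZ-0 p) g m) (modZ-p-Dvd (coef g m) (high m D<m)))

  DegModP≤deg : ∀ g D → DegModP g D → D ≤ deg g
  DegModP≤deg g D (top , _) = deg-≥ g D (λ eq → top (subst Dvd (sym eq) p∣0))

  Dvd? : ∀ a → Dvd a ⊎ ¬ Dvd a
  Dvd? a with p ℕD.∣? ℤ.∣ a ∣
  ... | yes d  = inj₁ (∣ᵤ⇒∣ d)
  ... | no ¬d = inj₂ (λ d → ¬d (∣⇒∣ᵤ d))

  DegModP-exists : ∀ f → ¬ All (λ a → + p ∣ a) f → Σ ℕ (DegModP f)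
  DegModP-exists []       ¬all = ⊥-elim (¬all [])
  DegModP-exists (a ∷ as) ¬all with All.all? (λ b → p ℕD.∣? ℤ.∣ b ∣) as
  ... | yes all = 0 , (λ d → ¬all (∣⇒∣ᵤ d ∷ all)) , λ { (suc m) _ → coef-Dvd as all m }
    where
    coef-Dvd : ∀ l → All (λ a → + p ∣ a) l → ∀ m → Dvd (coef l m)
    coef-Dvd []       _        m       = p∣0
    coef-Dvd (b ∷ bs) (d ∷ _)  zero    = ∣ᵤ⇒∣ d
    coef-Dvd (b ∷ bs) (_ ∷ ds) (suc m) = coef-Dvd bs ds m
  ... | no ¬all′ with DegModP-exists as ¬all′
  ...   | D , top , high = suc D , top , λ { (suc m) (s≤s D<m) → high m D<m }

  DegModP-≤ : ∀ g B j → j ≤ B → ¬ Dvd (coef g j) → (∀ m → B < m → Dvd (coef g m)) →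
              Σ ℕ λ D → D ≤ B × DegModP g D
  DegModP-≤ g B j j≤B unit high with Dvd? (coef g B)
  ... | inj₂ top = B , ℕP.≤-refl , top , high
  DegModP-≤ g zero    j z≤n unit high | inj₁ d = ⊥-elim (unit d)
  DegModP-≤ g (suc B) j j≤B unit high | inj₁ d with j ℕP.≟ suc B
  ... | yes refl = ⊥-elim (unit d)
  ... | no j≢B with DegModP-≤ g B j (ℕP.m<1+n⇒m≤n (ℕP.≤∧≢⇒< j≤B j≢B)) unit high′
    where
    high′ : ∀ m → B < m → Dvd (coef g m)
    high′ m B<m with m ℕP.≟ suc B
    ... | yes refl = d
    ... | no m≢B  = high m (ℕP.≤∧≢⇒< B<m (λ eq → m≢B (sym eq)))
  ...   | D , D≤B , hasDeg = D , ℕP.m≤n⇒m≤1+n D≤B , hasDeg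


  -- Below s(g, z) every Taylor coefficient at z vanishes modulo p: a unit
  -- coefficient of index j would give s(g, z) ≤ j + 0.
  IsS-RootMult : ∀ g z s → IsS p g z s → RootMult g z s
  IsS-RootMult g z s (_ , minimal) j j<s with Dvd? (taylor g j (+ z))
  ... | inj₁ d  = d
  ... | inj₂ ¬d = ⊥-elim (ℕP.<⇒≱ j<s (subst (s ≤_) (ℕP.+-identityʳ j) (minimal j 0 ord₀)))
    where
    ord₀ : Ord p (hasse g j (+ z)) 0
    ord₀ = ℕD.1∣ _ , λ d → ¬d (subst Dvd (hasse≡taylor g j (+ z))
                                (∣ᵤ⇒∣ (subst (ℕD._∣ ℤ.∣ hasse g j (+ z) ∣) (ℕP.*-identityʳ p) d)))

  IsS-unique : ∀ g z s s′ → IsS p g z s → IsS p g z s′ → s ≡ s′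
  IsS-unique g z s s′ ((i , v , o , i+v≡s) , minimal) ((i′ , v′ , o′ , i′+v′≡s′) , minimal′) =
    ℕP.≤-antisym (subst (s ≤_) i′+v′≡s′ (minimal i′ v′ o′)) (subst (s′ ≤_) i+v≡s (minimal′ i v o))

  p∣p^ : ∀ n → 0 < n → p ℕD.∣ p ^ n
  p∣p^ (suc n) _ = ℕD.m∣m*n (p ^ n)

  +p^-+ : ∀ a b → + (p ^ (a + b)) ≡ + (p ^ a) ℤ.* + (p ^ b)
  +p^-+ a b = trans (cong +_ (ℕP.^-distribˡ-+-* p a b)) (ℤP.pos-* (p ^ a) (p ^ b))

  divZ-0 : ∀ m → divZ m 0ℤ ≡ 0ℤ
  divZ-0 zero    = refl
  divZ-0 (suc m) = refl

  childPoly-coef : ∀ g κ z s j → coef (childPoly p g κ z s) j ≡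
                   modZ (p ^ (κ ∸ s)) (divZ (p ^ s) (+ (p ^ j) ℤ.* taylor g j (+ z)))
  childPoly-coef g κ z s j = begin
    coef (reduce (p ^ (κ ∸ s)) (map (divZ (p ^ s)) (compose g (linear z p)))) j
      ≡⟨ coef-map (modZ (p ^ (κ ∸ s))) (modZ-0 (p ^ (κ ∸ s))) (map (divZ (p ^ s)) (compose g (linear z p))) j ⟩
    modZ (p ^ (κ ∸ s)) (coef (map (divZ (p ^ s)) (compose g (linear z p))) j)
      ≡⟨ cong (modZ (p ^ (κ ∸ s))) (coef-map (divZ (p ^ s)) (divZ-0 (p ^ s)) (compose g (linear z p)) j) ⟩
    modZ (p ^ (κ ∸ s)) (divZ (p ^ s) (coef (compose g (linear z p)) j))
      ≡⟨ cong (λ c → modZ (p ^ (κ ∸ s)) (divZ (p ^ s) c)) (coef-compose-linear g z p j) ⟩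
    modZ (p ^ (κ ∸ s)) (divZ (p ^ s) (+ (p ^ j) ℤ.* taylor g j (+ z)))
      ∎
    where open ≡-Reasoning

  -- A child polynomial has degree at most s modulo p: its coefficients of
  -- index j > s carry the factor p^{j-s}, while the index j₀ attaining
  -- s = j₀ + ord_p(taylor g j₀ z) yields a unit.
  childPoly-DegModP : ∀ g κ z s → ChildCond p g κ z s →
                      Σ ℕ λ D → D ≤ s × DegModP (childPoly p g κ z s) D
  childPoly-DegModP g κ z s (_ , ((j₀ , v₀ , (p^v₀∣ , p^v₀⁺¹∤) , j₀+v₀≡s) , _) , 2≤s , s≤κ∸1) =
    DegModP-≤ f₁ s j₀ (subst (j₀ ≤_) j₀+v₀≡s (ℕP.m≤m+n j₀ v₀)) unit high
    where
    f₁ = childPoly p g κ z s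
    M = p ^ (κ ∸ s)
    0<M : 0 < M
    0<M = ℕP.m^n>0 p (κ ∸ s)
    p∣M : p ℕD.∣ M
    p∣M = p∣p^ (κ ∸ s) (ℕP.m<n⇒0<n∸m (below-budget (ℕP.<-trans (s≤s z≤n) 2≤s) s≤κ∸1))
    high : ∀ m → s < m → Dvd (coef f₁ m)
    high m s<m = subst Dvd (sym (childPoly-coef g κ z s m)) (modZ-Dvd M 0<M p∣M _ (subst Dvd (sym quotient) p∣))
      where
      t = taylor g m (+ z)
      quotient : divZ (p ^ s) (+ (p ^ m) ℤ.* t) ≡ + (p ^ (m ∸ s)) ℤ.* t
      quotient = divZ-exact (p ^ s) (+ (p ^ (m ∸ s)) ℤ.* t) (ℕP.m^n>0 p s) (begin
        + (p ^ m) ℤ.* t                           ≡⟨ cong (λ e → + (p ^ e) ℤ.* t) (sym (ℕP.m∸n+n≡m (ℕP.<⇒≤ s<m))) ⟩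
        + (p ^ (m ∸ s + s)) ℤ.* t                 ≡⟨ cong (ℤ._* t) (+p^-+ (m ∸ s) s) ⟩
        (+ (p ^ (m ∸ s)) ℤ.* + (p ^ s)) ℤ.* t     ≡⟨ swap (+ (p ^ (m ∸ s))) (+ (p ^ s)) t ⟩
        (+ (p ^ (m ∸ s)) ℤ.* t) ℤ.* + (p ^ s)     ∎)
        where
        open ≡-Reasoning
        swap : ∀ (a b t : ℤ) → (a ℤ.* b) ℤ.* t ≡ (a ℤ.* t) ℤ.* b
        swap = solve-∀
      p∣ : Dvd (+ (p ^ (m ∸ s)) ℤ.* t)
      p∣ = ℤS.∣m⇒∣m*n t (∣ᵤ⇒∣ {+ p} {+ (p ^ (m ∸ s))} (p∣p^ (m ∸ s) (ℕP.m<n⇒0<n∸m s<m)))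
    -- taylor g j₀ z = u · p^{v₀} with u a unit modulo p.
    h = hasse g j₀ (+ z)
    u = ℤS._∣_.quotient (∣ᵤ⇒∣ {+ (p ^ v₀)} {h} p^v₀∣)
    h≡u*p^v₀ : h ≡ u ℤ.* + (p ^ v₀)
    h≡u*p^v₀ = ℤS._∣_.equality (∣ᵤ⇒∣ {+ (p ^ v₀)} {h} p^v₀∣)
    ¬p∣u : ¬ Dvd u
    ¬p∣u (divides w u≡w*p) = p^v₀⁺¹∤ (∣⇒∣ᵤ (divides w (begin
      h                                ≡⟨ h≡u*p^v₀ ⟩
      u ℤ.* + (p ^ v₀)                 ≡⟨ cong (ℤ._* + (p ^ v₀)) u≡w*p ⟩
      (w ℤ.* + p) ℤ.* + (p ^ v₀)       ≡⟨ ℤP.*-assoc w (+ p) (+ (p ^ v₀)) ⟩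
      w ℤ.* (+ p ℤ.* + (p ^ v₀))       ≡⟨ cong (w ℤ.*_) (sym (ℤP.pos-* p (p ^ v₀))) ⟩
      w ℤ.* + (p ^ suc v₀)             ∎)))
      where open ≡-Reasoning
    quotient₀ : divZ (p ^ s) (+ (p ^ j₀) ℤ.* taylor g j₀ (+ z)) ≡ u
    quotient₀ = divZ-exact (p ^ s) u (ℕP.m^n>0 p s) (begin
      + (p ^ j₀) ℤ.* taylor g j₀ (+ z)        ≡⟨ cong (+ (p ^ j₀) ℤ.*_) (trans (sym (hasse≡taylor g j₀ (+ z))) h≡u*p^v₀) ⟩
      + (p ^ j₀) ℤ.* (u ℤ.* + (p ^ v₀))       ≡⟨ swap (+ (p ^ j₀)) u (+ (p ^ v₀)) ⟩
      u ℤ.* (+ (p ^ j₀) ℤ.* + (p ^ v₀))       ≡⟨ cong (u ℤ.*_) (sym (+p^-+ j₀ v₀)) ⟩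
      u ℤ.* + (p ^ (j₀ + v₀))                 ≡⟨ cong (λ e → u ℤ.* + (p ^ e)) j₀+v₀≡s ⟩
      u ℤ.* + (p ^ s)                         ∎)
      where
      open ≡-Reasoning
      swap : ∀ (a u b : ℤ) → a ℤ.* (u ℤ.* b) ≡ u ℤ.* (a ℤ.* b)
      swap = solve-∀
    unit : ¬ Dvd (coef f₁ j₀)
    unit d = ¬p∣u (modZ-Dvd⁻ M 0<M p∣M u
                    (subst Dvd (trans (childPoly-coef g κ z s j₀) (cong (modZ M) quotient₀)) d))


  open Shape p

  ChildCond-IsRoot : ∀ {g} κ (zs : ℕ × ℕ) → ChildCond p g κ (proj₁ zs) (proj₂ zs) → IsRoot g zs
  ChildCond-IsRoot κ (z , s) ((z<p , _) , isS , _) = z<p , IsS-RootMult _ z s isS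

  children-sum-bound : ∀ g κ D → DegModP g D → ∀ zss → Unique (map proj₁ zss) →
                       All (λ zs → ChildCond p g κ (proj₁ zs) (proj₂ zs)) zss → sum (map proj₂ zss) ≤ D
  children-sum-bound g κ D hasDeg zss uniq children =
    multiplicities-bounded zss g D hasDeg uniq (All.map (λ {zs} → ChildCond-IsRoot κ zs) children)

  with-values : ∀ g κ zs → All (λ z → ∃[ s ] ChildCond p g κ z s) zs →
                Σ (List (ℕ × ℕ)) λ zss → map proj₁ zss ≡ zs ×
                All (λ zs → ChildCond p g κ (proj₁ zs) (proj₂ zs)) zss × 2 * length zs ≤ sum (map proj₂ zss)
  with-values g κ []       []                  = [] , refl , [] , z≤n
  with-values g κ (z ∷ zs) ((s , cond) ∷ rest) with with-values g κ zs rest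
  ... | zss , refl , conds , bound =
    (z , s) ∷ zss , refl , cond ∷ conds ,
    subst (_≤ s + sum (map proj₂ zss)) (sym (ℕP.*-distribˡ-+ 2 1 (length zs)))
          (ℕP.+-mono-≤ (proj₁ (proj₂ (proj₂ cond))) bound)

  -- Parts (2) and (3): as each child has s ≥ 2, a node of degree D modulo p
  -- has at most ⌊D/2⌋ children.
  children-bound : ∀ g κ D → DegModP g D → ∀ zs → Unique zs →
                   All (λ z → ∃[ s ] ChildCond p g κ z s) zs → 2 * length zs ≤ D
  children-bound g κ D hasDeg zs uniq children with with-values g κ zs children
  ... | zss , refl , conds , bound = ℕP.≤-trans bound (children-sum-bound g κ D hasDeg zss uniq conds)

  node-DegModP : ∀ {k f D₀ i ζ g κ} → DegModP f D₀ → Node p k f i ζ g κ → Σ ℕ (DegModP g)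
  node-DegModP hasDeg₀ root = _ , hasDeg₀
  node-DegModP hasDeg₀ (child {g = g} {κ = κ} _ z s cond) =
    _ , proj₂ (proj₂ (childPoly-DegModP g κ z s cond))

  NodeAt : ℕ → ℕ → Poly → ℕ → Set
  NodeAt i k f ζ = ∃[ g ] ∃[ κ ] Node p k f i ζ g κ

  SubtreeBound : ℕ → Set
  SubtreeBound i = ∀ k f z s → ChildCond p f k z s → ∀ ζs → Unique ζs →
                   All (NodeAt i (k ∸ s) (childPoly p f k z s)) ζs → 2 * length ζs ≤ s

  open ByKey (_% p)

  into-subtree : ∀ {i k f z s} → ChildCond p f k z s → ∀ {ζ} → ζ % p ≡ z → NodeAt (suc i) k f ζ →
                 NodeAt i (k ∸ s) (childPoly p f k z s) (ζ / p)
  into-subtree {i} {k} {f} {z} {s} cond ζ%p≡z (g , κ , node) with descend node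
  ... | z₀ , s₀ , cond₀ , ζ′ , ζ≡ , node′ with digits (proj₁ (proj₁ cond₀)) ζ≡
  ...   | ζ%p≡z₀ , ζ/p≡ζ′ with trans (sym ζ%p≡z₀) ζ%p≡z
  ...     | refl with IsS-unique f z s s₀ (proj₁ (proj₂ cond)) (proj₁ (proj₂ cond₀))
  ...       | refl = g , κ , subst (λ ζ″ → Node p (k ∸ s) (childPoly p f k z s) i ζ″ g κ) (sym ζ/p≡ζ′) node′

  same-digit-injective : ∀ {z ζ ζ′} → ζ % p ≡ z → ζ′ % p ≡ z → ζ / p ≡ ζ′ / p → ζ ≡ ζ′
  same-digit-injective {z} {ζ} {ζ′} ζ%p≡z ζ′%p≡z ζ/p≡ζ′/p = begin
    ζ                    ≡⟨ m≡m%n+[m/n]*n ζ p ⟩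
    ζ % p + ζ / p * p    ≡⟨ cong₂ (λ r q → r + q * p) (trans ζ%p≡z (sym ζ′%p≡z)) ζ/p≡ζ′/p ⟩
    ζ′ % p + ζ′ / p * p  ≡⟨ sym (m≡m%n+[m/n]*n ζ′ p) ⟩
    ζ′                   ∎
    where open ≡-Reasoning

  group-bound : ∀ {i k f z s} → SubtreeBound i → ChildCond p f k z s →
                ∀ G → Unique G → All (λ ζ → ζ % p ≡ z) G → All (NodeAt (suc i) k f) G → 2 * length G ≤ s
  group-bound {i} {k} {f} {z} {s} bound cond G uniq lastDigits nodes =
    subst (λ n → 2 * n ≤ s) (length-map (_/ p) G)
      (bound k f z s cond (map (_/ p) G) (map-Unique (_/ p) same-digit-injective lastDigits uniq)
             (AllP.map⁺ (All.zipWith (λ (ζ%p≡z , node) → into-subtree cond ζ%p≡z node) (lastDigits , nodes))))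

  group-contribution : ∀ {i k f} → SubtreeBound i → ∀ z G → Unique G → All (λ ζ → ζ % p ≡ z) G →
                       All (NodeAt (suc i) k f) G →
                       length G ≡ 0 ⊎ Σ ℕ λ s → ChildCond p f k z s × 2 * length G ≤ s
  group-contribution bound z []      _    _                      _ = inj₁ refl
  group-contribution bound z (ζ ∷ G) uniq lastDigits@(ζ%p≡z ∷ _) nodes@((_ , _ , node) ∷ _)
    with descend node
  ... | z₀ , s , cond , ζ′ , ζ≡ , _ with trans (sym (proj₁ (digits (proj₁ (proj₁ cond)) ζ≡))) ζ%p≡z
  ...   | refl = inj₂ (s , cond , group-bound bound cond (ζ ∷ G) uniq lastDigits nodes)

  -- Going through the last digits B = 0, 1, …: the nodes of depth i+1 whose
  -- last digit is below B are accounted for by distinct children of the root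
  -- with digits below B, at a cost of at most s/2 nodes per child (z, s).
  tally : ∀ {i k f} → SubtreeBound i → ∀ ζs → Unique ζs → All (NodeAt (suc i) k f) ζs → ∀ B →
          Σ (List (ℕ × ℕ)) λ zss → Unique (map proj₁ zss) ×
          All (λ zs → proj₁ zs < B × ChildCond p f k (proj₁ zs) (proj₂ zs)) zss ×
          2 * countBelow B ζs ≤ sum (map proj₂ zss)
  tally bound ζs uniq nodes zero = [] , [] , [] , z≤n
  tally bound ζs uniq nodes (suc B)
    with tally bound ζs uniq nodes B
       | group-contribution bound B (group B ζs) (group-Unique B uniq) (group-key B ζs) (group-All B nodes)
  ... | zss , uniqs , conds , counted | inj₁ empty =
    zss , uniqs , All.map (λ (z<B , cond) → ℕP.m≤n⇒m≤1+n z<B , cond) conds ,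
    subst (λ n → 2 * n ≤ sum (map proj₂ zss))
          (sym (trans (cong (_+_ (countBelow B ζs)) empty) (ℕP.+-identityʳ (countBelow B ζs)))) counted
  ... | zss , uniqs , conds , counted | inj₂ (s , cond , grouped) =
    (B , s) ∷ zss , AllP.map⁺ (All.map (λ (z<B , _) eq → ℕP.<-irrefl (sym eq) z<B) conds) ∷ uniqs ,
    (ℕP.≤-refl , cond) ∷ All.map (λ (z<B , cond) → ℕP.m≤n⇒m≤1+n z<B , cond) conds ,
    subst (_≤ s + sum (map proj₂ zss))
          (trans (ℕP.+-comm (2 * length (group B ζs)) (2 * countBelow B ζs))
                 (sym (ℕP.*-distribˡ-+ 2 (countBelow B ζs) (length (group B ζs)))))
          (ℕP.+-mono-≤ grouped counted)

  level-from-subtrees : ∀ {i} → SubtreeBound i → ∀ k f D → DegModP f D →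
                        ∀ ζs → Unique ζs → All (NodeAt (suc i) k f) ζs → 2 * length ζs ≤ D
  level-from-subtrees bound k f D hasDeg ζs uniq nodes with tally bound ζs uniq nodes p
  ... | zss , uniqs , conds , counted = begin
    2 * length ζs          ≡⟨ cong (2 *_) (length-by-groups p ζs (All.tabulate (λ {ζ} _ → m%n<n ζ p))) ⟩
    2 * countBelow p ζs    ≤⟨ counted ⟩
    sum (map proj₂ zss)    ≤⟨ children-sum-bound f k D hasDeg zss uniqs (All.map proj₂ conds) ⟩
    D                      ∎
    where open ℕP.≤-Reasoning

  -- SubtreeBound holds at every depth: at depth 0 the subtree has only its
  -- root and s ≥ 2; deeper, apply the level count to the child polynomial,
  -- whose degree modulo p is at most s.
  subtree-bound : ∀ i → SubtreeBound i
  subtree-bound zero k f z s (_ , _ , 2≤s , _) ζs uniq nodes =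
    ℕP.≤-trans (ℕP.*-monoʳ-≤ 2 (Unique-constant ζs (All.map (λ (_ , _ , node) → root-unique node) nodes) uniq)) 2≤s
  subtree-bound (suc i) k f z s cond ζs uniq nodes =
    ℕP.≤-trans (level-from-subtrees {i} (subtree-bound i) (k ∸ s) (childPoly p f k z s) D₁ hasDeg₁ ζs uniq nodes)
               D₁≤s
    where
    D₁ = proj₁ (childPoly-DegModP f k z s cond)
    D₁≤s = proj₁ (proj₂ (childPoly-DegModP f k z s cond))
    hasDeg₁ = proj₂ (proj₂ (childPoly-DegModP f k z s cond))

  level-bound : ∀ i k f D → DegModP f D → ∀ ζs → Unique ζs → All (NodeAt (suc i) k f) ζs → 2 * length ζs ≤ D
  level-bound i = level-from-subtrees (subtree-bound i)

  -- Part (4), total: grouping nodes by depth, depth 0 holds only the root,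
  -- each depth b+1 at most ⌊d/2⌋ nodes, and no depth exceeds ⌊(k-1)/2⌋.
  total-bound : ∀ k f D d → DegModP f D → D ≤ d → ∀ ns → Unique ns →
                All (λ n → NodeAt (proj₁ n) k f (proj₂ n)) ns → length ns ≤ 1 + (d / 2) * ((k ∸ 1) / 2)
  total-bound k f D d hasDeg D≤d ns uniq nodes = begin
    length ns
      ≡⟨ Depth.length-by-groups (suc L) ns (All.map (λ (_ , _ , node) → s≤s (depth-bound node)) nodes) ⟩
    Depth.countBelow (suc L) ns    ≤⟨ by-depth L ⟩
    1 + L * (d / 2)                ≡⟨ cong suc (ℕP.*-comm L (d / 2)) ⟩
    1 + (d / 2) * L                ∎
    where
    open ℕP.≤-Reasoning
    module Depth = ByKey {ℕ × ℕ} proj₁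
    L = (k ∸ 1) / 2

    at-root : ∀ {n} → proj₁ n ≡ 0 → NodeAt (proj₁ n) k f (proj₂ n) → n ≡ (0 , 0)
    at-root {0 , ζ} refl (_ , _ , node) = cong (_,_ 0) (root-unique node)

    depth-zero : length (Depth.group 0 ns) ≤ 1
    depth-zero = Unique-constant (Depth.group 0 ns)
      (All.zipWith (λ (depth≡0 , node) → at-root depth≡0 node) (Depth.group-key 0 ns , Depth.group-All 0 nodes))
      (Depth.group-Unique 0 uniq)

    same-depth-injective : ∀ b {n n′ : ℕ × ℕ} → proj₁ n ≡ b → proj₁ n′ ≡ b → proj₂ n ≡ proj₂ n′ → n ≡ n′
    same-depth-injective b {_ , _} {_ , _} refl refl refl = refl

    at-depth : ∀ b {n} → proj₁ n ≡ b → NodeAt (proj₁ n) k f (proj₂ n) → NodeAt b k f (proj₂ n)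
    at-depth b refl node = node

    depth-suc : ∀ b → length (Depth.group (suc b) ns) ≤ d / 2
    depth-suc b = half-≤ (length G) d (ℕP.≤-trans (subst (λ n → 2 * n ≤ D) (length-map proj₂ G)
      (level-bound b k f D hasDeg (map proj₂ G)
        (map-Unique proj₂ (same-depth-injective (suc b))
                    (Depth.group-key (suc b) ns) (Depth.group-Unique (suc b) uniq))
        (AllP.map⁺ (All.zipWith (λ (depth≡ , node) → at-depth (suc b) depth≡ node)
                                (Depth.group-key (suc b) ns , Depth.group-All (suc b) nodes))))) D≤d)
      where G = Depth.group (suc b) ns

    by-depth : ∀ B → Depth.countBelow (suc B) ns ≤ 1 + B * (d / 2)
    by-depth zero    = depth-zero
    by-depth (suc B) = begin
      Depth.countBelow (suc B) ns + length (Depth.group (suc B) ns)  ≤⟨ ℕP.+-mono-≤ (by-depth B) (depth-suc B) ⟩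
      1 + B * (d / 2) + d / 2                                        ≡⟨ cong suc (ℕP.+-comm (B * (d / 2)) (d / 2)) ⟩
      1 + suc B * (d / 2)                                            ∎

  child-bounds : ∀ {k f D₀ i μ g κ} → DegModP f D₀ → Node p k f i μ g κ → ∀ z s → ChildCond p g κ z s →
                 (∀ (zs : List ℕ) → Unique zs →
                    All (λ z′ → ∃[ s′ ] ChildCond p (childPoly p g κ z s) (κ ∸ s) z′ s′) zs →
                    length zs ≤ s / 2)
                 × deg (reduce p (childPoly p g κ z s)) ≤ s
                 × s ≤ κ ∸ 1
                 × κ ∸ 1 ≤ k ∸ 1
                 × (∀ (zss : List (ℕ × ℕ)) → Unique (map proj₁ zss) →
                      All (λ zs′ → ChildCond p g κ (proj₁ zs′) (proj₂ zs′)) zss →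
                      sum (map proj₂ zss) ≤ deg (reduce p g))
  child-bounds {g = g} {κ} hasDeg₀ node z s cond@(_ , _ , _ , s≤κ∸1) =
    (λ zs uniq children → half-≤ (length zs) s
       (ℕP.≤-trans (children-bound (childPoly p g κ z s) (κ ∸ s) D₁ hasDeg₁ zs uniq children) D₁≤s)) ,
    subst (_≤ s) (sym (reduce-deg (childPoly p g κ z s) D₁ hasDeg₁)) D₁≤s ,
    s≤κ∸1 ,
    ℕP.∸-monoˡ-≤ 1 (κ≤k node) ,
    λ zss uniq conds → subst (sum (map proj₂ zss) ≤_) (sym (reduce-deg g D hasDeg))
                             (children-sum-bound g κ D hasDeg zss uniq conds)
    where
    D₁ = proj₁ (childPoly-DegModP g κ z s cond)
    D₁≤s = proj₁ (proj₂ (childPoly-DegModP g κ z s cond))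
    hasDeg₁ = proj₂ (proj₂ (childPoly-DegModP g κ z s cond))
    D = proj₁ (node-DegModP hasDeg₀ node)
    hasDeg = proj₂ (node-DegModP hasDeg₀ node)


lemma3p3 : (k p : ℕ) → Prime p → (f : Poly) → (d : ℕ) →
           deg f ≡ d →
           ¬ All (λ a → + p ∣ a) f →
           -- (1) depth bound
           (∀ {i ζ g κ} → Node p k f i ζ g κ → i ≤ (k ∸ 1) / 2)
           -- (2) degree of the root node
           × (∀ (zs : List ℕ) → Unique zs →
                All (λ z → ∃[ s ] ChildCond p f k z s) zs →
                length zs ≤ d / 2)
           -- (3) non-root node (childPoly p g κ z s , κ ∸ s) with parent (g , κ), ζ_{i-1} = z
           × (∀ {i μ g κ} → Node p k f i μ g κ → ∀ z s → ChildCond p g κ z s →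
                (∀ (zs : List ℕ) → Unique zs →
                   All (λ z′ → ∃[ s′ ] ChildCond p (childPoly p g κ z s) (κ ∸ s) z′ s′) zs →
                   length zs ≤ s / 2)
                × deg (reduce p (childPoly p g κ z s)) ≤ s
                × s ≤ κ ∸ 1
                × κ ∸ 1 ≤ k ∸ 1
                × (∀ (zss : List (ℕ × ℕ)) → Unique (map proj₁ zss) →
                     All (λ zs′ → ChildCond p g κ (proj₁ zs′) (proj₂ zs′)) zss →
                     sum (map proj₂ zss) ≤ deg (reduce p g)))
           -- (4) nodes per level and in total
           × (∀ i → 1 ≤ i → ∀ (ζs : List ℕ) → Unique ζs →
                All (λ ζ → ∃[ g ] ∃[ κ ] Node p k f i ζ g κ) ζs →
                length ζs ≤ d / 2)
           × (∀ (ns : List (ℕ × ℕ)) → Unique ns →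
                All (λ n → ∃[ g ] ∃[ κ ] Node p k f (proj₁ n) (proj₂ n) g κ) ns →
                length ns ≤ 1 + (d / 2) * ((k ∸ 1) / 2))
lemma3p3 k p p-prime f d deg-f≡d nonzero =
  depth-bound ,
  (λ zs uniq children →
     half-≤ (length zs) d (ℕP.≤-trans (children-bound f k D₀ hasDeg₀ zs uniq children) D₀≤d)) ,
  child-bounds hasDeg₀ ,
  level ,
  total-bound k f D₀ d hasDeg₀ D₀≤d
  where
  open Shape p
  open ModP p p-prime
  D₀ : ℕ
  D₀ = proj₁ (DegModP-exists f nonzero)
  hasDeg₀ : DegModP f D₀
  hasDeg₀ = proj₂ (DegModP-exists f nonzero)
  D₀≤d : D₀ ≤ d
  D₀≤d = subst (D₀ ≤_) deg-f≡d (DegModP≤deg f D₀ hasDeg₀)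
  level : ∀ i → 1 ≤ i → ∀ (ζs : List ℕ) → Unique ζs → All (NodeAt i k f) ζs → length ζs ≤ d / 2
  level (suc i) _ ζs uniq nodes =
    half-≤ (length ζs) d (ℕP.≤-trans (level-bound i k f D₀ hasDeg₀ ζs uniq nodes) D₀≤d)
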